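{- Let $H$ be a linear hypergraph, $\mathscr{N}$ a forest of copies in $H$, and $e\in E(H)$ with $e^+\in\mathscr{N}$. Then $\mathscr{N}\setminus\{e^+\}$ is again a forest of copies.
   Context: Hypergraphs are pairs $(V,E)$ with $E$ a set of $k$-subsets of a finite set $V$; linear means two distinct edges share at most one vertex. For $e\in E(H)$, $e^+$ denotes the subhypergraph $(e,\{e\})$ (an edge copy). For a finite set $\mathscr{N}$ of subhypergraphs of $H$, an enumeration $(F_1,\dots,F_{|\mathscr{N}|})$ is admissible if for every $j\in[2,|\mathscr{N}|]$ the set $z_j=V(F_j)\cap\bigcup_{i<j}V(F_i)$ either is an edge in $E(F_j)\cap\bigcup_{i<j}E(F_i)$ or has at most one element; $\mathscr{N}$ is a forest of copies if it has an admissible enumeration (the empty set counts as a forest of copies). -}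

module Defs where

open import Data.Nat using (ℕ; _≤_)
open import Data.Fin using (Fin)
open import Data.Fin.Subset using (Subset; _∈_; _⊆_; _∩_; _∪_; ⁅_⁆; ∣_∣; ⊥)
open import Data.Vec using (Vec; lookup)
open import Data.Bool using (Bool)
open import Data.Product using (Σ; ∃; _×_; _,_; proj₁; proj₂)
open import Data.Sum using (_⊎_)
open import Data.Unit using (⊤)
open import Data.List using (List; []; _∷_; filter)
open import Data.List.Relation.Binary.Permutation.Propositional using (_↭_)
open import Relation.Binary.PropositionalEquality using (_≡_; _≢_)
open import Relation.Binary.Definitions using (DecidableEquality)
open import Relation.Nullary using (¬?)
import Data.Vec.Properties as VecP
import Data.Product.Properties as ProdP
import Data.Bool.Properties as BoolP
open import Function.Definitions using (Injective)

record Hypergraph : Set where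
  field
    n     : ℕ
    k     : ℕ
    m     : ℕ
    edge  : Vec (Subset n) m
    uniform  : ∀ t → ∣ lookup edge t ∣ ≡ k
    distinct : Injective _≡_ _≡_ (lookup edge)

open Hypergraph public

Linear : Hypergraph → Set
Linear H = ∀ s t → s ≢ t → ∣ lookup (edge H) s ∩ lookup (edge H) t ∣ ≤ 1

-- A candidate subhypergraph: a vertex subset V(F) and a set E(F) of edges of H
-- (as a subset of the edge indices).
SubH : Hypergraph → Set
SubH H = Subset (n H) × Subset (m H)

Vof : {H : Hypergraph} → SubH H → Subset (n H)
Vof = proj₁

Eof : {H : Hypergraph} → SubH H → Subset (m H)
Eof = proj₂

IsSubhypergraph : (H : Hypergraph) → SubH H → Set
IsSubhypergraph H F = ∀ t → t ∈ Eof {H} F → lookup (edge H) t ⊆ Vof {H} F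

_≟SubH_ : {H : Hypergraph} → DecidableEquality (SubH H)
_≟SubH_ = ProdP.≡-dec (VecP.≡-dec BoolP._≟_) (VecP.≡-dec BoolP._≟_)

edgeCopy : (H : Hypergraph) → Fin (m H) → SubH H
edgeCopy H t = lookup (edge H) t , ⁅ t ⁆

-- Condition on F_j given U = ⋃_{i<j} V(F_i) and D = ⋃_{i<j} E(F_i):
-- z_j = V(F_j) ∩ U is an edge in E(F_j) ∩ D, or |z_j| ≤ 1.
AdmCond : (H : Hypergraph) → Subset (n H) → Subset (m H) → SubH H → Set
AdmCond H U D F =
  (Σ (Fin (m H)) λ t → t ∈ Eof {H} F × t ∈ D × lookup (edge H) t ≡ (Vof {H} F ∩ U))
  ⊎ ∣ Vof {H} F ∩ U ∣ ≤ 1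

AdmFrom : (H : Hypergraph) → Subset (n H) → Subset (m H) → List (SubH H) → Set
AdmFrom H U D []       = ⊤
AdmFrom H U D (F ∷ Fs) = AdmCond H U D F × AdmFrom H (U ∪ Vof {H} F) (D ∪ Eof {H} F) Fs

Admissible : (H : Hypergraph) → List (SubH H) → Set
Admissible H []       = ⊤
Admissible H (F ∷ Fs) = AdmFrom H (Vof {H} F) (Eof {H} F) Fs

-- A finite set 𝒩 of subhypergraphs is represented by a duplicate-free list;
-- it is a forest of copies if some enumeration (reordering) of it is admissible.
ForestOfCopies : (H : Hypergraph) → List (SubH H) → Set
ForestOfCopies H 𝒩 = ∃ λ L → L ↭ 𝒩 × Admissible H L

remove : (H : Hypergraph) → SubH H → List (SubH H) → List (SubH H)
remove H F 𝒩 = filter (λ G → ¬? (_≟SubH_ {H} G F)) 𝒩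

-- Write the admissible enumeration as P, e⁺, S and delete e⁺.  For every later member G
-- this removes the vertices of e and the edge e from the union (U, D) of the members
-- before G.  A condition |z| ≤ 1 survives, and so does a condition "z is the edge t ∈ D"
-- unless t = e; hence nothing breaks if e ∈ E(P) or no member of S contains the edge e.
-- Otherwise let F ∈ S contain it.  At F's position z ⊇ e, so for k ≥ 2 the set z is an
-- edge t ⊇ e, and t = e by linearity: F meets everything before it exactly in e.  Hence
-- F meets V(P) only inside e, in at most one vertex because e⁺ was admissible and
-- e ∉ E(P), so F can take the place of e⁺; the members between them then see V(F)
-- instead of e, which they meet only inside e.  For k ≤ 1 every condition amounts to
-- |z| ≤ 1, which survives any shrinking of U.
module Submission where

open import Defs
open import Data.Fin using (Fin)
open import Data.List using (List)
open import Data.List.Relation.Unary.All using (All)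
open import Data.List.Relation.Unary.Unique.Propositional using (Unique)
open import Data.List.Membership.Propositional using (_∈_)

open import Algebra.Bundles using (CommutativeMonoid)
import Algebra.Properties.CommutativeSemigroup as CommutativeSemigroupProperties
open import Data.Empty using (⊥-elim)
open import Data.Fin using (_≟_)
open import Data.Fin.Subset using (Subset; _⊆_; _∩_; _∪_; ⁅_⁆; ∣_∣)
  renaming (_∈_ to _∈ₛ_; _∉_ to _∉ₛ_; ⊥ to ∅)
open import Data.Fin.Subset.Properties
  using ( x∈p∩q⁺; x∈p∩q⁻; x∈p∪q⁺; x∈p∪q⁻; p⊆p∪q; q⊆p∪q; p⊆q⇒∣p∣≤∣q∣
        ; ⊆-antisym; ⊆-reflexive; ⊆-trans; x∈⁅y⁆⇒x≡y; ∉⊥; ∣⊥∣≡0; ∣p∩q∣≤∣q∣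
        ; ∪-identityˡ; ∪-commutativeMonoid; _∈?_ )
open import Data.List using ([]; _∷_; _++_; foldl; filter)
open import Data.List.Membership.Propositional using (find)
open import Data.List.Membership.Propositional.Properties using (∈-∃++)
open import Data.List.Properties using (filter-accept; filter-reject; filter-all)
open import Data.List.Relation.Binary.Permutation.Propositional
  using (_↭_; ↭-refl; ↭-sym; ↭-trans; ↭⇒↭ₛ)
open import Data.List.Relation.Binary.Permutation.Propositional.Properties
  using (All-resp-↭; ∈-resp-↭; filter-↭; shift; ++⁺ˡ)
import Data.List.Relation.Binary.Permutation.Setoid.Properties as SetoidPermutation
open import Data.List.Relation.Unary.All using ([]; _∷_; tabulate)
  renaming (map to mapAll; head to headAll)
open import Data.List.Relation.Unary.All.Properties using (++⁻; ++⁻ʳ; ¬Any⇒All¬)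
open import Data.List.Relation.Unary.Any using (any?; here; there)
open import Data.List.Relation.Unary.AllPairs using (_∷_)
open import Data.Nat using (_≤_; _<_; z≤n; _≤?_)
open import Data.Nat.Properties using (≤-trans; ≤-reflexive; <⇒≱; ≰⇒>)
open import Data.Product using (∃; _×_; _,_; proj₁; proj₂)
import Data.Product as Product
open import Data.Sum using (inj₁; inj₂; [_,_])
import Data.Sum as Sum
open import Data.Unit using (tt)
open import Data.Vec using (lookup)
open import Function using (id; _∘_)
open import Relation.Binary.Definitions using (DecidableEquality)
open import Relation.Binary.PropositionalEquality
  using (_≡_; refl; sym; trans; cong; subst; subst₂; ≢-sym; setoid; module ≡-Reasoning)
open import Relation.Nullary using (yes; no; ¬?)

∪-mono : ∀ {p} {A B C D : Subset p} → A ⊆ B → C ⊆ D → A ∪ C ⊆ B ∪ D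
∪-mono A⊆B C⊆D x∈ = x∈p∪q⁺ (Sum.map A⊆B C⊆D (x∈p∪q⁻ _ _ x∈))

∪-least : ∀ {p} {A B C : Subset p} → A ⊆ C → B ⊆ C → A ∪ B ⊆ C
∪-least A⊆C B⊆C x∈ = [ A⊆C , B⊆C ] (x∈p∪q⁻ _ _ x∈)

⁅⁆⊆ : ∀ {p} {x : Fin p} {A : Subset p} → x ∈ₛ A → ⁅ x ⁆ ⊆ A
⁅⁆⊆ {x = x} x∈A y∈ = subst (_∈ₛ _) (sym (x∈⁅y⁆⇒x≡y x y∈)) x∈A

∩-monoʳ : ∀ {p} {A B C : Subset p} → B ⊆ C → A ∩ B ⊆ A ∩ C
∩-monoʳ B⊆C x∈ = x∈p∩q⁺ (Product.map id B⊆C (x∈p∩q⁻ _ _ x∈))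

∩-restrictʳ : ∀ {p} {A B C : Subset p} → A ∩ B ⊆ C → A ∩ B ⊆ A ∩ C
∩-restrictʳ A∩B⊆C x∈ = x∈p∩q⁺ (proj₁ (x∈p∩q⁻ _ _ x∈) , A∩B⊆C x∈)

unionWith : ∀ {X : Set} {p} → (X → Subset p) → Subset p → List X → Subset p
unionWith f = foldl (λ A x → A ∪ f x)

module _ {X : Set} {p} (f : X → Subset p) where

  ⊆-unionWith : ∀ {A} xs → A ⊆ unionWith f A xs
  ⊆-unionWith []       = id
  ⊆-unionWith (x ∷ xs) = ⊆-unionWith xs ∘ p⊆p∪q _

  ∈⇒⊆-unionWith : ∀ {A x} xs → x ∈ xs → f x ⊆ unionWith f A xs
  ∈⇒⊆-unionWith (_ ∷ xs) (here refl) = ⊆-unionWith xs ∘ q⊆p∪q _ _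
  ∈⇒⊆-unionWith (_ ∷ xs) (there x∈) = ∈⇒⊆-unionWith xs x∈

  unionWith-mono : ∀ {A B} xs → A ⊆ B → unionWith f A xs ⊆ unionWith f B xs
  unionWith-mono []       A⊆B = A⊆B
  unionWith-mono (x ∷ xs) A⊆B = unionWith-mono xs (∪-mono A⊆B id)

  unionWith-∪ : ∀ A C xs → unionWith f (A ∪ C) xs ≡ unionWith f A xs ∪ C
  unionWith-∪ A C []       = refl
  unionWith-∪ A C (x ∷ xs) = begin
    unionWith f ((A ∪ C) ∪ f x) xs ≡⟨ cong (λ B → unionWith f B xs) (xy∙z≈xz∙y A C (f x)) ⟩
    unionWith f ((A ∪ f x) ∪ C) xs ≡⟨ unionWith-∪ (A ∪ f x) C xs ⟩
    unionWith f (A ∪ f x) xs ∪ C   ∎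
    where
    open ≡-Reasoning
    open CommutativeSemigroupProperties
      (CommutativeMonoid.commutativeSemigroup (∪-commutativeMonoid p))

filter-≢-++-∷ : ∀ {A : Set} (_≟ᴬ_ : DecidableEquality A) P {x : A} {S} →
  Unique (P ++ x ∷ S) → filter (λ y → ¬? (y ≟ᴬ x)) (P ++ x ∷ S) ≡ P ++ S
filter-≢-++-∷ _≟ᴬ_ [] (x∉S ∷ _) =
  trans (filter-reject (λ y → ¬? (y ≟ᴬ _)) (λ x≢x → x≢x refl))
        (filter-all (λ y → ¬? (y ≟ᴬ _)) (mapAll ≢-sym x∉S))
filter-≢-++-∷ _≟ᴬ_ (y ∷ P) (y∉ ∷ unique) =
  trans (filter-accept (λ z → ¬? (z ≟ᴬ _)) (headAll (++⁻ʳ P y∉)))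
        (cong (y ∷_) (filter-≢-++-∷ _≟ᴬ_ P unique))

module _ {H : Hypergraph} where

  V : SubH H → Subset (n H)
  V = proj₁

  E : SubH H → Subset (m H)
  E = proj₂

  edgeOf : Fin (m H) → Subset (n H)
  edgeOf = lookup (edge H)

  edge-⊆⇒k≤∣∣ : ∀ {t A} → edgeOf t ⊆ A → k H ≤ ∣ A ∣
  edge-⊆⇒k≤∣∣ {t} t⊆A = subst (_≤ _) (uniform H t) (p⊆q⇒∣p∣≤∣q∣ t⊆A)

  edge-⊆⇒≡ : Linear H → 1 < k H → ∀ {s t} → edgeOf s ⊆ edgeOf t → s ≡ t
  edge-⊆⇒≡ linear 1<k {s} {t} s⊆t with s ≟ t
  ... | yes s≡t = s≡t
  ... | no s≢t  = ⊥-elim (<⇒≱ 1<k (≤-trans k≤∣s∩t∣ (linear s t s≢t)))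
    where
    k≤∣s∩t∣ : k H ≤ ∣ edgeOf s ∩ edgeOf t ∣
    k≤∣s∩t∣ = edge-⊆⇒k≤∣∣ (λ x∈s → x∈p∩q⁺ (x∈s , s⊆t x∈s))

  Covers : Subset (n H) → Subset (m H) → Set
  Covers U D = ∀ {t} → t ∈ₛ D → edgeOf t ⊆ U

  Covers-∅ : Covers ∅ ∅
  Covers-∅ t∈∅ = ⊥-elim (∉⊥ t∈∅)

  Covers-∪ : ∀ {U D G} → Covers U D → IsSubhypergraph H G → Covers (U ∪ V G) (D ∪ E G)
  Covers-∪ covers sub t∈ = [ (λ t∈D → p⊆p∪q _ ∘ covers t∈D) , (λ t∈G → q⊆p∪q _ _ ∘ sub _ t∈G) ]
                             (x∈p∪q⁻ _ _ t∈)

  Covers-unionWith : ∀ {U D} Gs → Covers U D → All (IsSubhypergraph H) Gs →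
    Covers (unionWith V U Gs) (unionWith E D Gs)
  Covers-unionWith []       covers []           = covers
  Covers-unionWith (G ∷ Gs) covers (sub ∷ subs) = Covers-unionWith Gs (Covers-∪ covers sub) subs

  AdmFrom-++⁻ : ∀ {U D} P {R} → AdmFrom H U D (P ++ R) →
    AdmFrom H U D P × AdmFrom H (unionWith V U P) (unionWith E D P) R
  AdmFrom-++⁻ []      adm         = tt , adm
  AdmFrom-++⁻ (G ∷ P) (cond , adm) with AdmFrom-++⁻ P adm
  ... | admP , admR = (cond , admP) , admR

  AdmFrom-++⁺ : ∀ {U D} P {R} → AdmFrom H U D P →
    AdmFrom H (unionWith V U P) (unionWith E D P) R → AdmFrom H U D (P ++ R)
  AdmFrom-++⁺ []      _             admR = admR
  AdmFrom-++⁺ (G ∷ P) (cond , admP) admR = cond , AdmFrom-++⁺ P admP admR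

  Admissible⇒AdmFrom-∅ : ∀ L → Admissible H L → AdmFrom H ∅ ∅ L
  Admissible⇒AdmFrom-∅ []      _   = tt
  Admissible⇒AdmFrom-∅ (F ∷ L) adm =
    inj₂ (≤-trans (∣p∩q∣≤∣q∣ (V F) ∅) (≤-trans (≤-reflexive (∣⊥∣≡0 (n H))) z≤n)) ,
    subst₂ (λ U D → AdmFrom H U D L) (sym (∪-identityˡ _)) (sym (∪-identityˡ _)) adm

  AdmFrom-∅⇒Admissible : ∀ L → AdmFrom H ∅ ∅ L → Admissible H L
  AdmFrom-∅⇒Admissible []      _          = tt
  AdmFrom-∅⇒Admissible (F ∷ L) (_ , adm) =
    subst₂ (λ U D → AdmFrom H U D L) (∪-identityˡ _) (∪-identityˡ _) adm

  Replaceable : Subset (n H) → Subset (m H) → Subset (n H) → Subset (m H) → SubH H → Set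
  Replaceable U D U′ D′ G = (V G ∩ U′ ⊆ U) × (E G ∩ D ⊆ D′)

  Replaceable-⊆ : ∀ {U D U′ D′ G} → U′ ⊆ U → D ⊆ D′ → Replaceable U D U′ D′ G
  Replaceable-⊆ U′⊆U D⊆D′ = U′⊆U ∘ proj₂ ∘ x∈p∩q⁻ _ _ , D⊆D′ ∘ proj₂ ∘ x∈p∩q⁻ _ _

  Replaceable-∪ : ∀ {U D U′ D′ A B G} → Replaceable U D U′ D′ G →
    Replaceable (U ∪ A) (D ∪ B) (U′ ∪ A) (D′ ∪ B) G
  Replaceable-∪ (vertices , edges) = restrict vertices , restrict edges
    where
    restrict : ∀ {p} {S X Y Z : Subset p} → S ∩ X ⊆ Y → S ∩ (X ∪ Z) ⊆ Y ∪ Z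
    restrict S∩X⊆Y x∈ with x∈p∩q⁻ _ _ x∈
    ... | x∈S , x∈X∪Z = [ (λ x∈X → p⊆p∪q _ (S∩X⊆Y (x∈p∩q⁺ (x∈S , x∈X)))) , q⊆p∪q _ _ ]
                          (x∈p∪q⁻ _ _ x∈X∪Z)

  AdmCond-transfer : ∀ {U D U′ D′ G} → IsSubhypergraph H G → Covers U′ D′ →
    Replaceable U D U′ D′ G → AdmCond H U D G → AdmCond H U′ D′ G
  AdmCond-transfer _ _ (vertices , _) (inj₂ small) =
    inj₂ (≤-trans (p⊆q⇒∣p∣≤∣q∣ (∩-restrictʳ vertices)) small)
  AdmCond-transfer {U′ = U′} {D′} {G} sub covers (vertices , edges)
                   (inj₁ (t , t∈G , t∈D , t≡z)) =
    inj₁ (t , t∈G , t∈D′ , ⊆-antisym t⊆z z⊆t)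
    where
    t∈D′ : t ∈ₛ D′
    t∈D′ = edges (x∈p∩q⁺ (t∈G , t∈D))
    t⊆z : edgeOf t ⊆ V G ∩ U′
    t⊆z x∈t = x∈p∩q⁺ (sub t t∈G x∈t , covers t∈D′ x∈t)
    z⊆t : V G ∩ U′ ⊆ edgeOf t
    z⊆t = ⊆-trans (∩-restrictʳ vertices) (⊆-reflexive (sym t≡z))

  AdmFrom-transfer : ∀ {U D U′ D′} Gs → All (IsSubhypergraph H) Gs → Covers U′ D′ →
    All (Replaceable U D U′ D′) Gs → AdmFrom H U D Gs → AdmFrom H U′ D′ Gs
  AdmFrom-transfer []       _            _      _             _            = tt
  AdmFrom-transfer (G ∷ Gs) (sub ∷ subs) covers (repl ∷ repls) (cond , adm) =
    AdmCond-transfer sub covers repl cond ,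
    AdmFrom-transfer Gs subs (Covers-∪ covers sub) (mapAll Replaceable-∪ repls) adm

  AdmCond-small : ∀ {U D U′ D′ G} → k H ≤ 1 → U′ ⊆ U → AdmCond H U D G → AdmCond H U′ D′ G
  AdmCond-small {G = G} k≤1 U′⊆U cond =
    inj₂ (≤-trans (p⊆q⇒∣p∣≤∣q∣ (∩-monoʳ {A = V G} U′⊆U)) (small cond))
    where
    small : ∀ {U D} → AdmCond H U D G → ∣ V G ∩ U ∣ ≤ 1
    small (inj₂ ∣z∣≤1)             = ∣z∣≤1
    small (inj₁ (t , _ , _ , t≡z)) =
      subst (λ z → ∣ z ∣ ≤ 1) t≡z (subst (_≤ 1) (sym (uniform H t)) k≤1)

  AdmFrom-small : ∀ {U D U′ D′} Gs → k H ≤ 1 → U′ ⊆ U → AdmFrom H U D Gs → AdmFrom H U′ D′ Gs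
  AdmFrom-small []       _   _    _            = tt
  AdmFrom-small (G ∷ Gs) k≤1 U′⊆U (cond , adm) =
    AdmCond-small k≤1 U′⊆U cond , AdmFrom-small Gs k≤1 (∪-mono U′⊆U id) adm

  AdmCond-edgeCopy : ∀ {U D e} → e ∉ₛ D → AdmCond H U D (edgeCopy H e) → ∣ edgeOf e ∩ U ∣ ≤ 1
  AdmCond-edgeCopy _   (inj₂ ∣z∣≤1)             = ∣z∣≤1
  AdmCond-edgeCopy e∉D (inj₁ (t , t∈e , t∈D , _)) =
    ⊥-elim (e∉D (subst (_∈ₛ _) (x∈⁅y⁆⇒x≡y _ t∈e) t∈D))

  AdmCond-⊇edge : Linear H → 1 < k H → ∀ {e W D F} → edgeOf e ⊆ V F ∩ W →
    AdmCond H W D F → V F ∩ W ≡ edgeOf e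
  AdmCond-⊇edge _      1<k e⊆z (inj₂ ∣z∣≤1) =
    ⊥-elim (<⇒≱ 1<k (≤-trans (edge-⊆⇒k≤∣∣ e⊆z) ∣z∣≤1))
  AdmCond-⊇edge linear 1<k e⊆z (inj₁ (t , _ , _ , t≡z))
    with edge-⊆⇒≡ linear 1<k (⊆-trans e⊆z (⊆-reflexive (sym t≡z)))
  ... | refl = sym t≡z

  AdmFrom-dropEdgeCopy : ∀ {U D e} S → Covers U D → All (IsSubhypergraph H) S →
    All (λ G → e ∈ₛ E G → e ∈ₛ D) S →
    AdmFrom H (U ∪ edgeOf e) (D ∪ ⁅ e ⁆) S → AdmFrom H U D S
  AdmFrom-dropEdgeCopy {U} {D} {e} S covers subs e∈⇒e∈D =
    AdmFrom-transfer S subs covers (mapAll replaceable e∈⇒e∈D)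
    where
    replaceable : ∀ {G} → (e ∈ₛ E G → e ∈ₛ D) → Replaceable (U ∪ edgeOf e) (D ∪ ⁅ e ⁆) U D G
    replaceable {G} e∈G⇒e∈D = p⊆p∪q _ ∘ proj₂ ∘ x∈p∩q⁻ _ _ , edges
      where
      edges : E G ∩ (D ∪ ⁅ e ⁆) ⊆ D
      edges t∈ with x∈p∩q⁻ _ _ t∈
      ... | t∈G , t∈D∪e = [ id , t∈e⇒t∈D ] (x∈p∪q⁻ _ _ t∈D∪e)
        where
        t∈e⇒t∈D : _ ∈ₛ ⁅ e ⁆ → _ ∈ₛ D
        t∈e⇒t∈D t∈e = ⁅⁆⊆ (e∈G⇒e∈D (subst (_∈ₛ E G) (x∈⁅y⁆⇒x≡y e t∈e) t∈G)) t∈e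

  AdmFrom-moveForward : Linear H → 1 < k H → ∀ {U D e} S₁ F S₂ → Covers U D → e ∉ₛ D →
    e ∈ₛ E F → All (IsSubhypergraph H) (S₁ ++ F ∷ S₂) →
    AdmFrom H U D (edgeCopy H e ∷ S₁ ++ F ∷ S₂) → AdmFrom H U D (F ∷ S₁ ++ S₂)
  AdmFrom-moveForward linear 1<k {U} {D} {e} S₁ F S₂ covers e∉D e∈F subs (cond-e , adm)
    with AdmFrom-++⁻ S₁ adm | ++⁻ S₁ subs
  ... | adm₁ , cond-F , adm₂ | subs₁ , subF ∷ subs₂ =
    inj₂ (≤-trans (p⊆q⇒∣p∣≤∣q∣ F∩U⊆e∩U) (AdmCond-edgeCopy e∉D cond-e)) ,
    AdmFrom-++⁺ S₁ adm₁′ adm₂′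
    where
    W : Subset (n H)
    W = unionWith V (U ∪ edgeOf e) S₁

    F∩W≡e : V F ∩ W ≡ edgeOf e
    F∩W≡e = AdmCond-⊇edge linear 1<k e⊆F∩W cond-F
      where
      e⊆F∩W : edgeOf e ⊆ V F ∩ W
      e⊆F∩W x∈e = x∈p∩q⁺ (subF e e∈F x∈e , ⊆-unionWith V S₁ (q⊆p∪q _ _ x∈e))

    F∩W⊆e : ∀ {x} → x ∈ₛ V F → x ∈ₛ W → x ∈ₛ edgeOf e
    F∩W⊆e x∈F x∈W = subst (_ ∈ₛ_) F∩W≡e (x∈p∩q⁺ (x∈F , x∈W))

    F∩U⊆e∩U : V F ∩ U ⊆ edgeOf e ∩ U
    F∩U⊆e∩U x∈ with x∈p∩q⁻ _ _ x∈
    ... | x∈F , x∈U = x∈p∩q⁺ (F∩W⊆e x∈F (⊆-unionWith V S₁ (p⊆p∪q _ x∈U)) , x∈U)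

    D∪e⊆D∪F : D ∪ ⁅ e ⁆ ⊆ D ∪ E F
    D∪e⊆D∪F = ∪-mono id (⁅⁆⊆ e∈F)

    replaceable₁ : ∀ {G} → G ∈ S₁ → Replaceable (U ∪ edgeOf e) (D ∪ ⁅ e ⁆) (U ∪ V F) (D ∪ E F) G
    replaceable₁ {G} G∈S₁ = vertices , D∪e⊆D∪F ∘ proj₂ ∘ x∈p∩q⁻ _ _
      where
      vertices : V G ∩ (U ∪ V F) ⊆ U ∪ edgeOf e
      vertices x∈ with x∈p∩q⁻ _ _ x∈
      ... | x∈G , x∈U∪F =
        x∈p∪q⁺ (Sum.map id (λ x∈F → F∩W⊆e x∈F (∈⇒⊆-unionWith V S₁ G∈S₁ x∈G)) (x∈p∪q⁻ _ _ x∈U∪F))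

    adm₁′ : AdmFrom H (U ∪ V F) (D ∪ E F) S₁
    adm₁′ = AdmFrom-transfer S₁ subs₁ (Covers-∪ covers subF) (tabulate replaceable₁) adm₁

    vertices₂ : unionWith V (U ∪ V F) S₁ ⊆ W ∪ V F
    vertices₂ = ∪-mono (unionWith-mono V S₁ (p⊆p∪q _)) id ∘ ⊆-reflexive (unionWith-∪ V U (V F) S₁)

    edges₂ : unionWith E (D ∪ ⁅ e ⁆) S₁ ∪ E F ⊆ unionWith E (D ∪ E F) S₁
    edges₂ = ∪-least (unionWith-mono E S₁ D∪e⊆D∪F) (⊆-unionWith E S₁ ∘ q⊆p∪q _ _)

    adm₂′ : AdmFrom H (unionWith V (U ∪ V F) S₁) (unionWith E (D ∪ E F) S₁) S₂
    adm₂′ = AdmFrom-transfer S₂ subs₂ (Covers-unionWith S₁ (Covers-∪ covers subF) subs₁)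
              (tabulate (λ _ → Replaceable-⊆ vertices₂ edges₂)) adm₂

  removeEdgeCopy : Linear H → ∀ {U D e} S → Covers U D → All (IsSubhypergraph H) S →
    AdmFrom H U D (edgeCopy H e ∷ S) → ∃ λ S′ → S′ ↭ S × AdmFrom H U D S′
  removeEdgeCopy linear {U} {D} {e} S covers subs (cond-e , adm)
    with any? (λ G → e ∈? E G) S
  ... | no e∉S = S , ↭-refl ,
    AdmFrom-dropEdgeCopy S covers subs (mapAll (λ e∉G → ⊥-elim ∘ e∉G) (¬Any⇒All¬ S e∉S)) adm
  ... | yes e∈S with e ∈? D
  ...   | yes e∈D = S , ↭-refl , AdmFrom-dropEdgeCopy S covers subs (tabulate (λ _ _ → e∈D)) adm
  ...   | no e∉D with k H ≤? 1
  ...     | yes k≤1 = S , ↭-refl , AdmFrom-small S k≤1 (p⊆p∪q _) adm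
  ...     | no k≰1 with find e∈S
  ...       | F , F∈S , e∈F with ∈-∃++ F∈S
  ...         | S₁ , S₂ , refl = F ∷ S₁ ++ S₂ , ↭-sym (shift F S₁ S₂) ,
    AdmFrom-moveForward linear (≰⇒> k≰1) S₁ F S₂ covers e∉D e∈F subs (cond-e , adm)

lemma13p4 : (H : Hypergraph) → Linear H →
    (𝒩 : List (SubH H)) → Unique 𝒩 → All (IsSubhypergraph H) 𝒩 →
    ForestOfCopies H 𝒩 →
    (e : Fin (m H)) → edgeCopy H e ∈ 𝒩 →
    ForestOfCopies H (remove H (edgeCopy H e) 𝒩)
lemma13p4 H linear 𝒩 unique subs (L , L↭𝒩 , admissible) e e⁺∈𝒩
  with ∈-∃++ (∈-resp-↭ (↭-sym L↭𝒩) e⁺∈𝒩)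
... | P , S , refl
  with AdmFrom-++⁻ P (Admissible⇒AdmFrom-∅ _ admissible) | ++⁻ P (All-resp-↭ (↭-sym L↭𝒩) subs)
... | admP , admS | subsP , _ ∷ subsS
  with removeEdgeCopy linear S (Covers-unionWith {H = H} P (Covers-∅ {H}) subsP) subsS admS
... | S′ , S′↭S , admS′ =
  P ++ S′ ,
  ↭-trans (++⁺ˡ P S′↭S) (subst (_↭ remove H (edgeCopy H e) 𝒩) L∖e⁺≡P++S (filter-↭ _ L↭𝒩)) ,
  AdmFrom-∅⇒Admissible (P ++ S′) (AdmFrom-++⁺ P admP admS′)
  where
  L∖e⁺≡P++S : remove H (edgeCopy H e) (P ++ edgeCopy H e ∷ S) ≡ P ++ S
  L∖e⁺≡P++S = filter-≢-++-∷ (_≟SubH_ {H}) P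
                (SetoidPermutation.Unique-resp-↭ (setoid _) (↭⇒↭ₛ (↭-sym L↭𝒩)) unique)
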